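{- Let $p_\phi$ be a program that is safe with respect to a variable typing environment $\Gamma$ and a safe operator typing environment $\Delta$. For every command $c$ occurring in $p_\phi$ and all tiers $t,t_{in},t_{out}$, if $\Gamma,\Delta\vdash c:(t,t_{in},t_{out})$, then $\Gamma(x)\preceq t$ for every variable $x\in\mathcal{A}(c)$, where $\mathcal{A}(c)$ is the set of variables assigned to in $c$ (i.e. appearing on the left of some assignment $x:=e$ in $c$).
   Context: Programs. Fix a set of variables and a set of operators, each operator $\mathtt{op}$ having an arity $ar(\mathtt{op})\ge0$ and a total function $[\![\mathtt{op}]\!]$ on words. With a single oracle symbol $\phi$: expressions $e::=x\mid \mathtt{op}(e_1,\dots,e_{ar(\mathtt{op})})\mid \phi(e_1\upharpoonright e_2)$; commands $c::=\mathtt{skip}\mid x:=e\mid c_1;c_2\mid \mathtt{if}(e)\{c_1\}\,\mathtt{else}\,\{c_0\}\mid \mathtt{while}(e)\{c\}$; programs $p_\phi::=c\ \mathtt{return}\ x$. Operators. For words, $v\unlhd w$ means $v$ is a contiguous subword of $w$. $\mathtt{op}$ is neutral if $ar(\mathtt{op})=0$, or $[\![\mathtt{op}]\!]$ takes values in $\{0,1\}$, or for all $\bar w$ there is $i$ with $[\![\mathtt{op}]\!](\bar w)\unlhd w_i$. $\mathtt{op}$ is positive if there is a constant $c$ with $|[\![\mathtt{op}]\!](\bar w)|\le\max_i|w_i|+c$ for all $\bar w$. Typing. Tiers are natural numbers $\mathbf 0,\mathbf 1,\dots$ with the usual order $\preceq$ (strict: $\prec$), $\vee=\max$, $\wedge=\min$.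 A variable typing environment $\Gamma$ maps variables to tiers; an operator typing environment $\Delta$ assigns to each operator $\mathtt{op}$ and tier $t$ a set $\Delta(\mathtt{op})(t)$ of types $t_1\to\dots\to t_{ar(\mathtt{op})}\to t'$. Judgments $\Gamma,\Delta\vdash b:(t,t_{in},t_{out})$ are derived by the rules (writing $\vdash$ for $\Gamma,\Delta\vdash$, all tiers arbitrary): (V) $\vdash x:(\Gamma(x),t_{in},t_{out})$; (OP) if $t_1\to\dots\to t_n\to t\in\Delta(\mathtt{op})(t_{in})$ and $\vdash e_i:(t_i,t_{in},t_{out})$ for all $i\le n=ar(\mathtt{op})$ then $\vdash\mathtt{op}(e_1,\dots,e_n):(t,t_{in},t_{out})$; (OR) if $\vdash e_1:(t,t_{in},t_{out})$, $\vdash e_2:(t_{out},t_{in},t_{out})$, $t\prec t_{in}$ and $t\preceq t_{out}$ then $\vdash\phi(e_1\upharpoonright e_2):(t,t_{in},t_{out})$; (SUB) for a command $c$, if $\vdash c:(t,t_{in},t_{out})$ then $\vdash c:(t+1,t_{in},t_{out})$; (SK) $\vdash\mathtt{skip}:(\mathbf0,t_{in},t_{out})$; (A) if $\vdash x:(t_1,t_{in},t_{out})$, $\vdash e:(t_2,t_{in},t_{out})$, $t_1\preceq t_2$ then $\vdash x:=e:(t_1,t_{in},t_{out})$; (S) if $\vdash c_1:\tau$ and $\vdash c_2:\tau$ then $\vdash c_1;c_2:\tau$; (C) if $\vdash e:\tau$, $\vdash c_1:\tau$, $\vdash c_0:\tau$ then $\vdash\mathtt{if}(e)\{c_1\}\mathtt{else}\{c_0\}:\tau$;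 (W) if $\vdash e:(t,t_{in},t_{out})$, $\vdash c:(t,t,t_{out})$ and $\mathbf1\preceq t\preceq t_{out}$ then $\vdash\mathtt{while}(e)\{c\}:(t,t_{in},t_{out})$; (W$_0$) if $\vdash e:(t,t_{in},t)$, $\vdash c:(t,t,t)$ and $\mathbf1\preceq t$ then $\vdash\mathtt{while}(e)\{c\}:(t,t_{in},\mathbf0)$. Safety. $\Delta$ is safe if for each operator $\mathtt{op}$ it types with $ar(\mathtt{op})>0$: $\mathtt{op}$ is neutral or positive, $[\![\mathtt{op}]\!]$ is polynomial-time computable, and for every tier $t_{in}$ and every $t_1\to\dots\to t_n\to t\in\Delta(\mathtt{op})(t_{in})$: $t\preceq\wedge_i t_i\preceq\vee_i t_i\preceq t_{in}$, and $t\prec t_{in}$ if $\mathtt{op}$ is positive but not neutral. A program $c\ \mathtt{return}\ x$ is safe with respect to $\Gamma,\Delta$ if $\Delta$ is safe and $\Gamma,\Delta\vdash c:(t,t_{in},t_{out})$ for some tiers. -}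

module Defs where

open import Data.Nat using (ℕ; zero; suc; _+_; _≤_; _<_; _⊔_; _⊓_)
open import Data.Bool using (Bool; true; false)
open import Data.List using (List; []; _∷_; _++_; length)
open import Data.Vec using (Vec; []; _∷_; foldr; map)
open import Data.Product using (Σ; ∃; _×_; _,_)
open import Data.Sum using (_⊎_)
open import Relation.Binary.PropositionalEquality using (_≡_)

Word : Set
Word = List Bool

_⊴_ : Word → Word → Set
v ⊴ w = Σ Word λ u → Σ Word λ z → w ≡ u ++ (v ++ z)

w0 w1 : Word
w0 = false ∷ []
w1 = true ∷ []

record Signature : Set₁ where
  field
    Var : Set
    Op  : Set
    ar  : Op → ℕ
    sem : (o : Op) → Vec Word (ar o) → Word

module Lang (Sig : Signature) where
  open Signature Sig

  data Expr : Set where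
    var : Var → Expr
    op  : (o : Op) → Vec Expr (ar o) → Expr
    orc : Expr → Expr → Expr          -- φ(e₁ ↾ e₂)

  data Cmd : Set where
    skip   : Cmd
    _≔_    : Var → Expr → Cmd
    _︔_    : Cmd → Cmd → Cmd
    if_then_else_ : Expr → Cmd → Cmd → Cmd
    while_loop_ : Expr → Cmd → Cmd

  record Program : Set where
    constructor _return_
    field
      body : Cmd
      ret  : Var

  bodyOf : Program → Cmd
  bodyOf = Program.body

  data _⊑_ : Cmd → Cmd → Set where
    ⊑-refl  : ∀ {c} → c ⊑ c
    ⊑-seqˡ  : ∀ {c c₁ c₂} → c ⊑ c₁ → c ⊑ (c₁ ︔ c₂)
    ⊑-seqʳ  : ∀ {c c₁ c₂} → c ⊑ c₂ → c ⊑ (c₁ ︔ c₂)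
    ⊑-ifᵗ   : ∀ {c e c₁ c₀} → c ⊑ c₁ → c ⊑ (if e then c₁ else c₀)
    ⊑-ifᵉ   : ∀ {c e c₁ c₀} → c ⊑ c₀ → c ⊑ (if e then c₁ else c₀)
    ⊑-while : ∀ {c e c₁} → c ⊑ c₁ → c ⊑ (while e loop c₁)

  assigned : Cmd → List Var
  assigned skip = []
  assigned (x ≔ e) = x ∷ []
  assigned (c₁ ︔ c₂) = assigned c₁ ++ assigned c₂
  assigned (if e then c₁ else c₀) = assigned c₁ ++ assigned c₀
  assigned (while e loop c) = assigned c

  maxLen : ∀ {n} → Vec Word n → ℕ
  maxLen ws = foldr _ _⊔_ 0 (map length ws)

  data _∈ᵥ_ {A : Set} (a : A) : ∀ {n} → Vec A n → Set where
    here  : ∀ {n} {xs : Vec A n} → a ∈ᵥ (a ∷ xs)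
    there : ∀ {n b} {xs : Vec A n} → a ∈ᵥ xs → a ∈ᵥ (b ∷ xs)

  Neutral : Op → Set
  Neutral o = (ar o ≡ 0)
            ⊎ (∀ ws → (sem o ws ≡ w0) ⊎ (sem o ws ≡ w1))
            ⊎ (∀ ws → Σ Word λ w → (w ∈ᵥ ws) × (sem o ws ⊴ w))

  Positive : Op → Set
  Positive o = ∃ λ (c : ℕ) → ∀ ws → length (sem o ws) ≤ maxLen ws + c

  Tier : Set
  Tier = ℕ

  VarEnv : Set
  VarEnv = Var → Tier

  -- operator typing environment: Δ o tin ts t  means
  -- (t₁ → … → tₙ → t) ∈ Δ(o)(tin), with ts = (t₁, …, tₙ)
  OpEnv : Set₁
  OpEnv = (o : Op) → Tier → Vec Tier (ar o) → Tier → Set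

  module Typing (Γ : VarEnv) (Δ : OpEnv) where

    mutual
      data _⊢e_∶_ : Expr → Tier → Tier × Tier → Set where
        V  : ∀ {x tin tout} → var x ⊢e Γ x ∶ (tin , tout)
        OP : ∀ {o es ts t tin tout} → Δ o tin ts t →
             ⊢args es ∶ ts ∣ (tin , tout) → op o es ⊢e t ∶ (tin , tout)
        OR : ∀ {e₁ e₂ t tin tout} → e₁ ⊢e t ∶ (tin , tout) →
             e₂ ⊢e tout ∶ (tin , tout) → t < tin → t ≤ tout →
             orc e₁ e₂ ⊢e t ∶ (tin , tout)

      data ⊢args_∶_∣_ : ∀ {n} → Vec Expr n → Vec Tier n → Tier × Tier → Set where
        []  : ∀ {τ} → ⊢args [] ∶ [] ∣ τ
        _∷_ : ∀ {n e t τ} {es : Vec Expr n} {ts : Vec Tier n} →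
              e ⊢e t ∶ τ → ⊢args es ∶ ts ∣ τ → ⊢args (e ∷ es) ∶ (t ∷ ts) ∣ τ

    data _⊢c_∶_ : Cmd → Tier → Tier × Tier → Set where
      SUB : ∀ {c t τ} → c ⊢c t ∶ τ → c ⊢c suc t ∶ τ
      SK  : ∀ {τ} → skip ⊢c 0 ∶ τ
      A   : ∀ {x e t₂ τ} → e ⊢e t₂ ∶ τ → Γ x ≤ t₂ → (x ≔ e) ⊢c Γ x ∶ τ
      S   : ∀ {c₁ c₂ t τ} → c₁ ⊢c t ∶ τ → c₂ ⊢c t ∶ τ → (c₁ ︔ c₂) ⊢c t ∶ τ
      C   : ∀ {e c₁ c₀ t τ} → e ⊢e t ∶ τ → c₁ ⊢c t ∶ τ → c₀ ⊢c t ∶ τ →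
            (if e then c₁ else c₀) ⊢c t ∶ τ
      W   : ∀ {e c t tin tout} → e ⊢e t ∶ (tin , tout) → c ⊢c t ∶ (t , tout) →
            1 ≤ t → t ≤ tout → (while e loop c) ⊢c t ∶ (tin , tout)
      W₀  : ∀ {e c t tin} → e ⊢e t ∶ (tin , t) → c ⊢c t ∶ (t , t) →
            1 ≤ t → (while e loop c) ⊢c t ∶ (tin , 0)

  SafeOpEnv : (PolyTime : ∀ {n} → (Vec Word n → Word) → Set) → OpEnv → Set
  SafeOpEnv PolyTime Δ =
    ∀ (o : Op) (tin : Tier) (ts : Vec Tier (ar o)) (t : Tier) → Δ o tin ts t →
    1 ≤ ar o →
      (Neutral o ⊎ Positive o)
    × PolyTime (sem o)
    × (∀ {tᵢ} → tᵢ ∈ᵥ ts → t ≤ tᵢ × tᵢ ≤ tin)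
    × (Positive o → (Neutral o → Data.Empty.⊥) → t < tin)
    where import Data.Empty

  SafeProgram : (PolyTime : ∀ {n} → (Vec Word n → Word) → Set) →
                VarEnv → OpEnv → Program → Set
  SafeProgram PolyTime Γ Δ p =
    SafeOpEnv PolyTime Δ ×
    (∃ λ t → ∃ λ tin → ∃ λ tout → Typing._⊢c_∶_ Γ Δ (Program.body p) t (tin , tout))

module Submission where

open import Defs
open import Data.Nat using (ℕ; _≤_)
open import Data.Nat.Properties using (≤-refl; m≤n⇒m≤1+n)
open import Data.Vec using (Vec)
open import Data.Product using (_,_)
open import Data.List.Membership.Propositional using (_∈_)
open import Data.List.Relation.Unary.All as All using (All; []; _∷_)
open import Data.List.Relation.Unary.All.Properties using (++⁺)

-- Confinement holds for every typable command.
module Confinement (Sig : Signature) (Γ : Lang.VarEnv Sig) (Δ : Lang.OpEnv Sig) where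
  open Lang Sig
  open Typing Γ Δ

  assigned-tier≤ : ∀ {c t τ} → c ⊢c t ∶ τ → All (λ x → Γ x ≤ t) (assigned c)
  assigned-tier≤ (SUB d)       = All.map m≤n⇒m≤1+n (assigned-tier≤ d)
  assigned-tier≤ SK            = []
  assigned-tier≤ (A _ _)       = ≤-refl ∷ []
  assigned-tier≤ (S d₁ d₂)     = ++⁺ (assigned-tier≤ d₁) (assigned-tier≤ d₂)
  assigned-tier≤ (C _ d₁ d₀)   = ++⁺ (assigned-tier≤ d₁) (assigned-tier≤ d₀)
  assigned-tier≤ (W _ d _ _)   = assigned-tier≤ d
  assigned-tier≤ (W₀ _ d _)    = assigned-tier≤ d

lemma6p4 : (S : Signature) (PolyTime : ∀ {n} → (Vec Word n → Word) → Set)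
    → ∀ (Γ : Lang.VarEnv S) (Δ : Lang.OpEnv S) (p : Lang.Program S)
    → Lang.SafeProgram S PolyTime Γ Δ p
    → ∀ (c : Lang.Cmd S) → Lang._⊑_ S c (Lang.bodyOf S p)
    → ∀ (t tin tout : ℕ) → Lang.Typing._⊢c_∶_ S Γ Δ c t (tin , tout)
    → ∀ (x : Signature.Var S) → x ∈ Lang.assigned S c → Γ x ≤ t
lemma6p4 S _ Γ Δ _ _ _ _ _ _ _ d _ x∈ =
  All.lookup (Confinement.assigned-tier≤ S Γ Δ d) x∈
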